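{- For every term $r$, type variable $X$ and types $A,B$ such that $r\in[\![\forall X.A]\!]$, we have $r[B]\in[\![[X:=B]A]\!]$.
   Context: Polymorphic System I. Types: $A ::= X \mid A\Rightarrow A \mid A\wedge A \mid \forall X.A$ ($FTV$ free type variables, modulo $\alpha$). Type isomorphism $\equiv$: smallest congruence containing $A\wedge B\equiv B\wedge A$; $A\wedge(B\wedge C)\equiv(A\wedge B)\wedge C$; $A\Rightarrow(B\wedge C)\equiv(A\Rightarrow B)\wedge(A\Rightarrow C)$; $(A\wedge B)\Rightarrow C\equiv A\Rightarrow B\Rightarrow C$; $\forall X.(A\Rightarrow B)\equiv A\Rightarrow\forall X.B$ if $X\notin FTV(A)$; $\forall X.(A\wedge B)\equiv\forall X.A\wedge\forall X.B$. Terms: $r ::= x^A \mid \lambda x^A.r \mid rr \mid \langle r,r\rangle \mid \pi_A(r) \mid \Lambda X.r \mid r[A]$, typed by: $\Gamma,x:A\vdash x:A$; from $\Gamma\vdash r:A$, $A\equiv B$ infer $\Gamma\vdash r:B$; from $\Gamma,x:A\vdash r:B$ infer $\Gamma\vdash\lambda x^A.r:A\Rightarrow B$; from $\Gamma\vdash r:A\Rightarrow B$, $\Gamma\vdash s:A$ infer $\Gamma\vdash rs:B$; from $\Gamma\vdash r:A$, $\Gamma\vdash s:B$ infer $\Gamma\vdash\langle r,s\rangle:A\wedge B$; from $\Gamma\vdash r:A\wedge B$ infer $\Gamma\vdash\pi_A(r):A$; from $\Gamma\vdash r:A$, $X\notin FTV(\Gamma)$ infer $\Gamma\vdash\Lambda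 X.r:\forall X.A$; from $\Gamma\vdash r:\forall X.A$ infer $\Gamma\vdash r[B]:[X:=B]A$. Term equivalence $\rightleftarrows$: symmetric, closed under term constructors, generated by $\langle r,s\rangle\rightleftarrows\langle s,r\rangle$; $\langle r,\langle s,t\rangle\rangle\rightleftarrows\langle\langle r,s\rangle,t\rangle$; $\lambda x^A.\langle r,s\rangle\rightleftarrows\langle\lambda x^A.r,\lambda x^A.s\rangle$; $\langle r,s\rangle t\rightleftarrows\langle rt,st\rangle$; $r\langle s,t\rangle\rightleftarrows (rs)t$; $\Lambda X.\lambda x^A.r\rightleftarrows\lambda x^A.\Lambda X.r$ if $X\notin FTV(A)$; $(\lambda x^A.r)[B]\rightleftarrows\lambda x^A.(r[B])$; $\Lambda X.\langle r,s\rangle\rightleftarrows\langle\Lambda X.r,\Lambda X.s\rangle$; $\langle r,s\rangle[A]\rightleftarrows\langle r[A],s[A]\rangle$; $\pi_{\forall X.A}(\Lambda X.r)\rightleftarrows\Lambda X.\pi_A(r)$; $(\pi_{\forall X.B}(r))[A]\rightleftarrows\pi_{[X:=A]B}(r[A])$ if $r$ has type $\forall X.(B\wedge C)$. Reduction $\hookrightarrow$: closure under term constructors of $(\lambda x^A.r)s\hookrightarrow[x:=s]r$ if $s$ has type $A$; $(\Lambda X.r)[A]\hookrightarrow[X:=A]r$; $\pi_A(\langle r,s\rangle)\hookrightarrow r$ if $r$ has type $A$. $\to\ :=\ \rightleftarrows^*\circ\hookrightarrow\circ\rightleftarrows^*$; $\mathsf{SN}$ is the set of typed terms strongly normalising for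 $\to$. Elimination contexts (hole $[\cdot]_A$ of type $A$): $[\cdot]_A$ has type $A$; if $K$ has type $B\Rightarrow C$ and $s\in\mathsf{SN}$ has type $B$, then $Ks$ has type $C$; if $K$ has type $B\wedge C$ then $\pi_B(K)$ has type $B$; if $K$ has type $\forall X.B$ then $K[C]$ has type $[X:=C]B$. $K[t]$ is $K$ with its hole replaced by $t$. $\mathcal T(K)$: $\mathcal T([\cdot]_A)=\emptyset$, $\mathcal T(Ks)=\mathcal T(K)\uplus\{s\}$, $\mathcal T(\pi_B(K))=\mathcal T(K[C])=\mathcal T(K)$. $[\![A]\!]$ is the set of terms $r$ of type $A$ such that for every elimination context $K$ with hole of type $A$, whose type is a type variable, with all terms of $\mathcal T(K)$ in $\mathsf{SN}$, we have $K[r]\in\mathsf{SN}$. -}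

module Defs where

open import Data.Nat using (ℕ; zero; suc)
open import Data.List using (List; []; _∷_; map; _++_)
open import Data.List.Relation.Unary.All using (All)
open import Data.Product using (Σ; ∃; _×_; _,_)
open import Induction.WellFounded using (Acc)
open import Relation.Binary.Construct.Closure.ReflexiveTransitive using (Star)

-- Types of Polymorphic System I.
-- Type variables are de Bruijn indices (this is "types modulo α").
-- ∀' A binds index 0 in A.

infixr 7 _⇒_
infixr 8 _∧_

data Type : Set where
  tvar : ℕ → Type
  _⇒_  : Type → Type → Type
  _∧_  : Type → Type → Type
  ∀'   : Type → Type

extR : (ℕ → ℕ) → ℕ → ℕ
extR ρ zero    = zero
extR ρ (suc n) = suc (ρ n)

renTy : (ℕ → ℕ) → Type → Type
renTy ρ (tvar n) = tvar (ρ n)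
renTy ρ (A ⇒ B)  = renTy ρ A ⇒ renTy ρ B
renTy ρ (A ∧ B)  = renTy ρ A ∧ renTy ρ B
renTy ρ (∀' A)   = ∀' (renTy (extR ρ) A)

shTy : Type → Type
shTy = renTy suc

extS : (ℕ → Type) → ℕ → Type
extS σ zero    = tvar zero
extS σ (suc n) = shTy (σ n)

subTy : (ℕ → Type) → Type → Type
subTy σ (tvar n) = σ n
subTy σ (A ⇒ B)  = subTy σ A ⇒ subTy σ B
subTy σ (A ∧ B)  = subTy σ A ∧ subTy σ B
subTy σ (∀' A)   = ∀' (subTy (extS σ) A)

sub0 : Type → ℕ → Type
sub0 B zero    = B
sub0 B (suc n) = tvar n

-- A [ B ]  is  [X:=B]A  where A is the body of ∀X.A
_[_] : Type → Type → Type
A [ B ] = subTy (sub0 B) A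

-- Type isomorphism ≡ (written ≅): the smallest congruence containing
-- the six axioms.  In de Bruijn form the side condition X ∉ FTV(A)
-- of the ∀/⇒ axiom is expressed by shifting A.

infix 4 _≅_

data _≅_ : Type → Type → Set where
  ≅-refl  : ∀ {A} → A ≅ A
  ≅-sym   : ∀ {A B} → A ≅ B → B ≅ A
  ≅-trans : ∀ {A B C} → A ≅ B → B ≅ C → A ≅ C
  ≅-⇒     : ∀ {A A' B B'} → A ≅ A' → B ≅ B' → (A ⇒ B) ≅ (A' ⇒ B')
  ≅-∧     : ∀ {A A' B B'} → A ≅ A' → B ≅ B' → (A ∧ B) ≅ (A' ∧ B')
  ≅-∀     : ∀ {A A'} → A ≅ A' → ∀' A ≅ ∀' A'
  comm    : ∀ {A B} → (A ∧ B) ≅ (B ∧ A)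
  asso    : ∀ {A B C} → (A ∧ (B ∧ C)) ≅ ((A ∧ B) ∧ C)
  dist    : ∀ {A B C} → (A ⇒ (B ∧ C)) ≅ ((A ⇒ B) ∧ (A ⇒ C))
  curry   : ∀ {A B C} → ((A ∧ B) ⇒ C) ≅ (A ⇒ B ⇒ C)
  p-comm  : ∀ {A B} → ∀' (shTy A ⇒ B) ≅ (A ⇒ ∀' B)
  p-dist  : ∀ {A B} → ∀' (A ∧ B) ≅ (∀' A ∧ ∀' B)

-- Terms.  Term variables are de Bruijn indices into the typing
-- context; λ carries its type annotation (x^A), projections carry π_A.

data Term : Set where
  var  : ℕ → Term
  lam  : Type → Term → Term
  app  : Term → Term → Term
  pair : Term → Term → Term
  proj : Type → Term → Term
  Lam  : Term → Term
  tapp : Term → Type → Term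

renTT : (ℕ → ℕ) → Term → Term
renTT ρ (var x)    = var x
renTT ρ (lam A r)  = lam (renTy ρ A) (renTT ρ r)
renTT ρ (app r s)  = app (renTT ρ r) (renTT ρ s)
renTT ρ (pair r s) = pair (renTT ρ r) (renTT ρ s)
renTT ρ (proj A r) = proj (renTy ρ A) (renTT ρ r)
renTT ρ (Lam r)    = Lam (renTT (extR ρ) r)
renTT ρ (tapp r A) = tapp (renTT ρ r) (renTy ρ A)

subTT : (ℕ → Type) → Term → Term
subTT σ (var x)    = var x
subTT σ (lam A r)  = lam (subTy σ A) (subTT σ r)
subTT σ (app r s)  = app (subTT σ r) (subTT σ s)
subTT σ (pair r s) = pair (subTT σ r) (subTT σ s)
subTT σ (proj A r) = proj (subTy σ A) (subTT σ r)
subTT σ (Lam r)    = Lam (subTT (extS σ) r)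
subTT σ (tapp r A) = tapp (subTT σ r) (subTy σ A)

-- [X:=A]r  for r the body of ΛX.r
tsub0 : Type → Term → Term
tsub0 A r = subTT (sub0 A) r

renV : (ℕ → ℕ) → Term → Term
renV ρ (var x)    = var (ρ x)
renV ρ (lam A r)  = lam A (renV (extR ρ) r)
renV ρ (app r s)  = app (renV ρ r) (renV ρ s)
renV ρ (pair r s) = pair (renV ρ r) (renV ρ s)
renV ρ (proj A r) = proj A (renV ρ r)
renV ρ (Lam r)    = Lam (renV ρ r)
renV ρ (tapp r A) = tapp (renV ρ r) A

extV : (ℕ → Term) → ℕ → Term
extV σ zero    = var zero
extV σ (suc n) = renV suc (σ n)

-- going under a type binder: shift the type variables of the substitutes
extVT : (ℕ → Term) → ℕ → Term
extVT σ n = renTT suc (σ n)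

subV : (ℕ → Term) → Term → Term
subV σ (var x)    = σ x
subV σ (lam A r)  = lam A (subV (extV σ) r)
subV σ (app r s)  = app (subV σ r) (subV σ s)
subV σ (pair r s) = pair (subV σ r) (subV σ s)
subV σ (proj A r) = proj A (subV σ r)
subV σ (Lam r)    = Lam (subV (extVT σ) r)
subV σ (tapp r A) = tapp (subV σ r) A

vsub0 : Term → ℕ → Term
vsub0 s zero    = s
vsub0 s (suc n) = var n

-- [x:=s]r  for r the body of λx^A.r
_⟦_⟧ : Term → Term → Term
r ⟦ s ⟧ = subV (vsub0 s) r

-- Typing.  A context lists the types of the term variables (index 0
-- first).  Going under ΛX shifts the context, which is the de Bruijn
-- form of the side condition X ∉ FTV(Γ).

Ctx : Set
Ctx = List Type

shCtx : Ctx → Ctx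
shCtx = map shTy

infix 4 _∋_⦂_ _⊢_⦂_

data _∋_⦂_ : Ctx → ℕ → Type → Set where
  here  : ∀ {Γ A} → (A ∷ Γ) ∋ zero ⦂ A
  there : ∀ {Γ A B x} → Γ ∋ x ⦂ A → (B ∷ Γ) ∋ suc x ⦂ A

data _⊢_⦂_ (Γ : Ctx) : Term → Type → Set where
  ax   : ∀ {x A} → Γ ∋ x ⦂ A → Γ ⊢ var x ⦂ A
  conv : ∀ {r A B} → Γ ⊢ r ⦂ A → A ≅ B → Γ ⊢ r ⦂ B
  ⇒i   : ∀ {r A B} → (A ∷ Γ) ⊢ r ⦂ B → Γ ⊢ lam A r ⦂ A ⇒ B
  ⇒e   : ∀ {r s A B} → Γ ⊢ r ⦂ A ⇒ B → Γ ⊢ s ⦂ A → Γ ⊢ app r s ⦂ B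
  ∧i   : ∀ {r s A B} → Γ ⊢ r ⦂ A → Γ ⊢ s ⦂ B → Γ ⊢ pair r s ⦂ A ∧ B
  ∧e   : ∀ {r A B} → Γ ⊢ r ⦂ A ∧ B → Γ ⊢ proj A r ⦂ A
  ∀i   : ∀ {r A} → shCtx Γ ⊢ r ⦂ A → Γ ⊢ Lam r ⦂ ∀' A
  ∀e   : ∀ {r A} B → Γ ⊢ r ⦂ ∀' A → Γ ⊢ tapp r B ⦂ A [ B ]

-- Term equivalence ⇄ (relative to the context Γ, needed for the typing
-- side condition of the last rule): symmetric, closed under term
-- constructors, generated by the listed rules.

infix 4 _⊢_⇄_ _⊢_↪_ _⊢_⟶_

data _⊢_⇄_ : Ctx → Term → Term → Set where
  e-comm  : ∀ {Γ r s} → Γ ⊢ pair r s ⇄ pair s r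
  e-asso  : ∀ {Γ r s t} → Γ ⊢ pair r (pair s t) ⇄ pair (pair r s) t
  e-distλ : ∀ {Γ A r s} → Γ ⊢ lam A (pair r s) ⇄ pair (lam A r) (lam A s)
  e-distapp : ∀ {Γ r s t} → Γ ⊢ app (pair r s) t ⇄ pair (app r t) (app s t)
  e-curry : ∀ {Γ r s t} → Γ ⊢ app r (pair s t) ⇄ app (app r s) t
  e-P-comm1 : ∀ {Γ A r} → Γ ⊢ Lam (lam (shTy A) r) ⇄ lam A (Lam r)
  e-P-comm2 : ∀ {Γ A B r} → Γ ⊢ tapp (lam A r) B ⇄ lam A (tapp r B)
  e-P-dist1 : ∀ {Γ r s} → Γ ⊢ Lam (pair r s) ⇄ pair (Lam r) (Lam s)
  e-P-dist2 : ∀ {Γ r s A} → Γ ⊢ tapp (pair r s) A ⇄ pair (tapp r A) (tapp s A)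
  e-P-dist3 : ∀ {Γ A r} → Γ ⊢ proj (∀' A) (Lam r) ⇄ Lam (proj A r)
  e-P-dist4 : ∀ {Γ A B C r} → Γ ⊢ r ⦂ ∀' (B ∧ C) →
              Γ ⊢ tapp (proj (∀' B) r) A ⇄ proj (B [ A ]) (tapp r A)
  e-sym   : ∀ {Γ r s} → Γ ⊢ r ⇄ s → Γ ⊢ s ⇄ r
  c-lam   : ∀ {Γ A r r'} → (A ∷ Γ) ⊢ r ⇄ r' → Γ ⊢ lam A r ⇄ lam A r'
  c-appl  : ∀ {Γ r r' s} → Γ ⊢ r ⇄ r' → Γ ⊢ app r s ⇄ app r' s
  c-appr  : ∀ {Γ r s s'} → Γ ⊢ s ⇄ s' → Γ ⊢ app r s ⇄ app r s'
  c-pairl : ∀ {Γ r r' s} → Γ ⊢ r ⇄ r' → Γ ⊢ pair r s ⇄ pair r' s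
  c-pairr : ∀ {Γ r s s'} → Γ ⊢ s ⇄ s' → Γ ⊢ pair r s ⇄ pair r s'
  c-proj  : ∀ {Γ A r r'} → Γ ⊢ r ⇄ r' → Γ ⊢ proj A r ⇄ proj A r'
  c-Lam   : ∀ {Γ r r'} → shCtx Γ ⊢ r ⇄ r' → Γ ⊢ Lam r ⇄ Lam r'
  c-tapp  : ∀ {Γ A r r'} → Γ ⊢ r ⇄ r' → Γ ⊢ tapp r A ⇄ tapp r' A

data _⊢_↪_ : Ctx → Term → Term → Set where
  β-λ : ∀ {Γ A r s} → Γ ⊢ s ⦂ A → Γ ⊢ app (lam A r) s ↪ r ⟦ s ⟧
  β-Λ : ∀ {Γ A r} → Γ ⊢ tapp (Lam r) A ↪ tsub0 A r
  π-r : ∀ {Γ A r s} → Γ ⊢ r ⦂ A → Γ ⊢ proj A (pair r s) ↪ r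
  r-lam   : ∀ {Γ A r r'} → (A ∷ Γ) ⊢ r ↪ r' → Γ ⊢ lam A r ↪ lam A r'
  r-appl  : ∀ {Γ r r' s} → Γ ⊢ r ↪ r' → Γ ⊢ app r s ↪ app r' s
  r-appr  : ∀ {Γ r s s'} → Γ ⊢ s ↪ s' → Γ ⊢ app r s ↪ app r s'
  r-pairl : ∀ {Γ r r' s} → Γ ⊢ r ↪ r' → Γ ⊢ pair r s ↪ pair r' s
  r-pairr : ∀ {Γ r s s'} → Γ ⊢ s ↪ s' → Γ ⊢ pair r s ↪ pair r s'
  r-proj  : ∀ {Γ A r r'} → Γ ⊢ r ↪ r' → Γ ⊢ proj A r ↪ proj A r'
  r-Lam   : ∀ {Γ r r'} → shCtx Γ ⊢ r ↪ r' → Γ ⊢ Lam r ↪ Lam r'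
  r-tapp  : ∀ {Γ A r r'} → Γ ⊢ r ↪ r' → Γ ⊢ tapp r A ↪ tapp r' A

_⊢_⇄*_ : Ctx → Term → Term → Set
Γ ⊢ r ⇄* s = Star (Γ ⊢_⇄_) r s

_⊢_⟶_ : Ctx → Term → Term → Set
Γ ⊢ r ⟶ s = Σ Term λ r' → Σ Term λ s' →
              (Γ ⊢ r ⇄* r') × (Γ ⊢ r' ↪ s') × (Γ ⊢ s' ⇄* s)

-- SN: typed terms that are strongly normalising for ⟶
-- (every ⟶-reduction sequence from r is finite: r is accessible for
-- the converse of ⟶).
SN : Ctx → Term → Set
SN Γ r = (∃ λ A → Γ ⊢ r ⦂ A) × Acc (λ t s → Γ ⊢ s ⟶ t) r

data Elim : Set where
  hole  : Type → Elim
  eapp  : Elim → Term → Elim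
  eproj : Type → Elim → Elim
  etapp : Elim → Type → Elim

plug : Elim → Term → Term
plug (hole A)    t = t
plug (eapp K s)  t = app (plug K t) s
plug (eproj B K) t = proj B (plug K t)
plug (etapp K C) t = tapp (plug K t) C

-- 𝒯(K) (a multiset, represented as a list)
𝒯 : Elim → List Term
𝒯 (hole A)    = []
𝒯 (eapp K s)  = 𝒯 K ++ (s ∷ [])
𝒯 (eproj B K) = 𝒯 K
𝒯 (etapp K C) = 𝒯 K

-- ElimTy Γ A K T : K is an elimination context with hole of type A,
-- and K has type T.
data ElimTy (Γ : Ctx) (A : Type) : Elim → Type → Set where
  ty-hole  : ElimTy Γ A (hole A) A
  ty-conv  : ∀ {K T T'} → ElimTy Γ A K T → T ≅ T' → ElimTy Γ A K T'
  ty-app   : ∀ {K s B C} → ElimTy Γ A K (B ⇒ C) → SN Γ s → Γ ⊢ s ⦂ B →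
             ElimTy Γ A (eapp K s) C
  ty-proj  : ∀ {K B C} → ElimTy Γ A K (B ∧ C) → ElimTy Γ A (eproj B K) B
  ty-tapp  : ∀ {K B} C → ElimTy Γ A K (∀' B) → ElimTy Γ A (etapp K C) (B [ C ])

⟦_⟧ : Type → Ctx → Term → Set
⟦ A ⟧ Γ r = (Γ ⊢ r ⦂ A) ×
  (∀ K X → ElimTy Γ A K (tvar X) → All (SN Γ) (𝒯 K) → SN Γ (plug K r))

-- Instantiation at B is itself an elimination step: an elimination context K
-- for r[B] yields the context K[[·][B]] for r, with the same arguments 𝒯 and
-- the same result type, so the hypothesis on r applies.
module Submission where

open import Defs
open import Data.List using ([]; _∷_; _++_)
open import Data.List.Properties using (++-assoc; ++-identityʳ)
open import Data.List.Relation.Unary.All using (All)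
open import Data.Product using (_,_)
open import Relation.Binary.PropositionalEquality using (_≡_; refl; sym; cong; subst; module ≡-Reasoning)

infixl 5 _∘ₑ_

_∘ₑ_ : Elim → Elim → Elim
hole _    ∘ₑ L = L
eapp K s  ∘ₑ L = eapp (K ∘ₑ L) s
eproj B K ∘ₑ L = eproj B (K ∘ₑ L)
etapp K C ∘ₑ L = etapp (K ∘ₑ L) C

plug-∘ₑ : ∀ K L r → plug (K ∘ₑ L) r ≡ plug K (plug L r)
plug-∘ₑ (hole _)    L r = refl
plug-∘ₑ (eapp K s)  L r = cong (λ t → app t s) (plug-∘ₑ K L r)
plug-∘ₑ (eproj B K) L r = cong (proj B) (plug-∘ₑ K L r)
plug-∘ₑ (etapp K C) L r = cong (λ t → tapp t C) (plug-∘ₑ K L r)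

𝒯-∘ₑ : ∀ K L → 𝒯 (K ∘ₑ L) ≡ 𝒯 L ++ 𝒯 K
𝒯-∘ₑ (hole _)    L = sym (++-identityʳ (𝒯 L))
𝒯-∘ₑ (eapp K s)  L = begin
  𝒯 (K ∘ₑ L) ++ s ∷ []    ≡⟨ cong (_++ s ∷ []) (𝒯-∘ₑ K L) ⟩
  (𝒯 L ++ 𝒯 K) ++ s ∷ []  ≡⟨ ++-assoc (𝒯 L) (𝒯 K) (s ∷ []) ⟩
  𝒯 L ++ 𝒯 K ++ s ∷ []    ∎
  where open ≡-Reasoning
𝒯-∘ₑ (eproj B K) L = 𝒯-∘ₑ K L
𝒯-∘ₑ (etapp K C) L = 𝒯-∘ₑ K L

ElimTy-∘ₑ : ∀ {Γ A B K L T} → ElimTy Γ B K T → ElimTy Γ A L B → ElimTy Γ A (K ∘ₑ L) T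
ElimTy-∘ₑ ty-hole         l = l
ElimTy-∘ₑ (ty-conv k e)   l = ty-conv (ElimTy-∘ₑ k l) e
ElimTy-∘ₑ (ty-app k sn s) l = ty-app (ElimTy-∘ₑ k l) sn s
ElimTy-∘ₑ (ty-proj k)     l = ty-proj (ElimTy-∘ₑ k l)
ElimTy-∘ₑ (ty-tapp C k)   l = ty-tapp C (ElimTy-∘ₑ k l)

mainTheorem19 : ∀ (Γ : Ctx) (r : Term) (A B : Type) →
    ⟦ ∀' A ⟧ Γ r → ⟦ A [ B ] ⟧ Γ (tapp r B)
mainTheorem19 Γ r A B (⊢r , r-reducible) = ∀e B ⊢r , λ K X ⊢K 𝒯K-sn →
  subst (SN Γ) (plug-∘ₑ K inst r)
    (r-reducible (K ∘ₑ inst) X (ElimTy-∘ₑ ⊢K ⊢inst)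
      (subst (All (SN Γ)) (sym (𝒯-∘ₑ K inst)) 𝒯K-sn))
  where
  inst : Elim
  inst = etapp (hole (∀' A)) B

  ⊢inst : ElimTy Γ (∀' A) inst (A [ B ])
  ⊢inst = ty-tapp B ty-hole
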